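{- Let $H$ be a DAT-free digraph and let $f:V(H)^2\to V(H)$ be the map defined below (for any choice of the enumeration $C_1,\dots,C_{2k}$ described there). Then $f$ is a polymorphism of $H$, and for every pair of distinct vertices $x,y$ that is not an invertible pair, the restriction of $f$ to $\{x,y\}^2$ is a semi-lattice (i.e. $f(x,y)=f(y,x)$, $f(x,x)=x$, $f(y,y)=y$, and $f$ is associative on $\{x,y\}$).
   Context: A digraph $H$ is a finite set $V(H)$ with a binary relation $E(H)$ (arcs). A binary polymorphism of $H$ is a map $f:V(H)^2\to V(H)$ with $xx',yy'\in E(H)\Rightarrow f(x,y)f(x',y')\in E(H)$. $H^+$ is the digraph on all ordered pairs $(u,v)$ of vertices of $H$ with an arc from $(u,v)$ to $(u',v')$ if either $uu',vv'\in E(H)$ and $uv'\notin E(H)$, or $u'u,v'v\in E(H)$ and $v'u\notin E(H)$. Distinct vertices $u,v$ form an invertible pair iff $(u,v)$ and $(v,u)$ lie in the same strong component of $H^+$. A vertex $(x,y)$ of $H^+$ is special if $H^+$ has a directed path from $(x,y)$ to $(y,x)$; a strong component is special if its vertices are special. For a strong component $C$, its coupled component is $C'=\{(u,v):(v,u)\in C\}$; $C$ is co-special if $C'$ is special, and self-coupled if $C=C'$. Definition of $f$: $f(x,x)=x$ for all $x$. For $x\ne y$: if $(x,y)$ lies in a co-special, not self-coupled strong component, $f(x,y)=x$; if in a special, not self-coupled one, $f(x,y)=y$; if in a self-coupled one, $f(x,y)=y$. The strong components (of pairs $(x,y)$, $x\neq y$) that are neither special nor co-special are enumerated as $C_1,\dots,C_{2k}$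 such that every arc of $H^+$ between two of them goes from some $C_i$ to some $C_j$ with $i<j$, and $C_i$ is coupled with $C_{2k+1-i}$ for each $i\le k$ (such an enumeration exists: repeatedly take as the last remaining element a component with no arcs to the other remaining ones and as the first remaining element its coupled component); set $f(x,y)=y$ for $(x,y)\in C_1\cup\dots\cup C_k$ and $f(x,y)=x$ for $(x,y)\in C_{k+1}\cup\dots\cup C_{2k}$. A permutable triple consists of three distinct vertices $u,v,w$ with six vertices $s(u),b(u),s(v),b(v),s(w),b(w)$ such that for each $x\in\{u,v,w\}$, with $y,z$ the other two, there are a walk from $x$ to $s(x)$ and walks from $y$ and from $z$ to $b(x)$, all congruent (same pattern of forward/backward arcs), the first avoiding the other two (where $x_0\dots x_n$ avoids congruent $y_0\dots y_n$ if no forward step has $x_iy_{i+1}\in E(H)$ and no backward step has $y_{i+1}x_i\in E(H)$). A DAT is a permutable triple with each pair $s(x),b(x)$ invertible; DAT-free means no DAT. -}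

module Defs where

open import Data.Nat using (ℕ; zero; suc; _+_; _*_; _∸_; _≤_; _<_)
open import Data.Fin using (Fin; inject₁; fromℕ) renaming (suc to fsuc; zero to fzero)
open import Data.Bool using (Bool; true; false)
open import Data.Product using (Σ; ∃; ∃-syntax; _×_; _,_; proj₁; proj₂)
open import Data.Sum using (_⊎_)
open import Relation.Binary.PropositionalEquality using (_≡_; _≢_)
open import Relation.Nullary using (¬_)
open import Relation.Binary.Construct.Closure.ReflexiveTransitive using (Star)

module _ {n : ℕ} (E : Fin n → Fin n → Bool) where

  V : Set
  V = Fin n

  Arc : V → V → Set
  Arc u v = E u v ≡ true

  IsPolymorphism : (V → V → V) → Set
  IsPolymorphism f = ∀ x x' y y' → Arc x x' → Arc y y' → Arc (f x y) (f x' y')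

  P : Set
  P = V × V

  swap : P → P
  swap (u , v) = (v , u)

  Arc⁺ : P → P → Set
  Arc⁺ (u , v) (u' , v') =
      (Arc u u' × Arc v v' × ¬ Arc u v')
    ⊎ (Arc u' u × Arc v' v × ¬ Arc v' u)

  Reach : P → P → Set
  Reach = Star Arc⁺

  SameComp : P → P → Set
  SameComp p q = Reach p q × Reach q p

  Invertible : V → V → Set
  Invertible u v = u ≢ v × SameComp (u , v) (v , u)

  Special : P → Set
  Special p = Reach p (swap p)

  SpecialComp : P → Set
  SpecialComp p = ∀ q → SameComp q p → Special q

  -- the coupled component C' = {(u,v) : (v,u) ∈ C} of the component C of p
  -- is special
  CoSpecialComp : P → Set
  CoSpecialComp p = ∀ q → SameComp (swap q) p → Special q

  SelfCoupled : P → Set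
  SelfCoupled p = ∀ q → (SameComp q p → SameComp (swap q) p)
                      × (SameComp (swap q) p → SameComp q p)

  Neither : P → Set
  Neither (x , y) = x ≢ y × ¬ SpecialComp (x , y) × ¬ CoSpecialComp (x , y)

  -- An enumeration C₁,…,C₂ₖ of the neither-special-nor-co-special strong
  -- components, encoded by the index idx p ∈ {1,…,2k} of the component of p.
  record Enumeration : Set where
    field
      k       : ℕ
      idx     : P → ℕ
      range   : ∀ p → Neither p → 1 ≤ idx p × idx p ≤ 2 * k
      onto    : ∀ i → 1 ≤ i → i ≤ 2 * k → ∃[ p ] (Neither p × idx p ≡ i)
      sameIdx : ∀ p q → Neither p → Neither q → idx p ≡ idx q → SameComp p q
      idxSame : ∀ p q → Neither p → Neither q → SameComp p q → idx p ≡ idx q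
      order   : ∀ p q → Neither p → Neither q → Arc⁺ p q → ¬ SameComp p q →
                idx p < idx q
      coupled : ∀ p → Neither p → idx p ≤ k →
                Neither (swap p) × idx (swap p) ≡ (2 * k + 1) ∸ idx p

  record IsDefinedMap (e : Enumeration) (f : V → V → V) : Set where
    open Enumeration e
    field
      diag      : ∀ x → f x x ≡ x
      coSpecial : ∀ x y → x ≢ y → CoSpecialComp (x , y) →
                  ¬ SelfCoupled (x , y) → f x y ≡ x
      special   : ∀ x y → x ≢ y → SpecialComp (x , y) →
                  ¬ SelfCoupled (x , y) → f x y ≡ y
      selfCoup  : ∀ x y → x ≢ y → SelfCoupled (x , y) → f x y ≡ y
      lowHalf   : ∀ x y → Neither (x , y) → idx (x , y) ≤ k → f x y ≡ y
      highHalf  : ∀ x y → Neither (x , y) → k < idx (x , y) → f x y ≡ x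

  SemilatticeOn : (V → V → V) → V → V → Set
  SemilatticeOn f x y =
      f x y ≡ f y x × f x x ≡ x × f y y ≡ y
    × (∀ a b c → (a ≡ x ⊎ a ≡ y) → (b ≡ x ⊎ b ≡ y) → (c ≡ x ⊎ c ≡ y) →
         f (f a b) c ≡ f a (f b c))

  -- A walk of length m is a vertex sequence w : Fin (suc m) → V following a
  -- pattern pat : Fin m → Bool (true = forward step, false = backward step).
  -- Congruent walks are walks with the same pattern.

  IsWalk : {m : ℕ} → (Fin m → Bool) → (Fin (suc m) → V) → Set
  IsWalk {m} pat w = ∀ (i : Fin m) →
      (pat i ≡ true  → Arc (w (inject₁ i)) (w (fsuc i)))
    × (pat i ≡ false → Arc (w (fsuc i)) (w (inject₁ i)))

  Avoids : {m : ℕ} → (Fin m → Bool) → (Fin (suc m) → V) → (Fin (suc m) → V) → Set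
  Avoids {m} pat x y = ∀ (i : Fin m) →
      (pat i ≡ true  → ¬ Arc (x (inject₁ i)) (y (fsuc i)))
    × (pat i ≡ false → ¬ Arc (y (fsuc i)) (x (inject₁ i)))

  TripleCond : V → V → V → V → V → Set
  TripleCond x y z sx bx =
    Σ ℕ λ m → Σ (Fin m → Bool) λ pat →
    Σ (Fin (suc m) → V) λ wx → Σ (Fin (suc m) → V) λ wy → Σ (Fin (suc m) → V) λ wz →
        IsWalk pat wx × IsWalk pat wy × IsWalk pat wz
      × (wx fzero ≡ x × wx (fromℕ m) ≡ sx)
      × (wy fzero ≡ y × wy (fromℕ m) ≡ bx)
      × (wz fzero ≡ z × wz (fromℕ m) ≡ bx)
      × Avoids pat wx wy × Avoids pat wx wz

  PermutableTriple : (u v w su bu sv bv sw bw : V) → Set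
  PermutableTriple u v w su bu sv bv sw bw =
      u ≢ v × u ≢ w × v ≢ w
    × TripleCond u v w su bu
    × TripleCond v u w sv bv
    × TripleCond w u v sw bw

  DAT : (u v w su bu sv bv sw bw : V) → Set
  DAT u v w su bu sv bv sw bw =
      PermutableTriple u v w su bu sv bv sw bw
    × Invertible su bu × Invertible sv bv × Invertible sw bw

  DATFree : Set
  DATFree = ∀ u v w su bu sv bv sw bw → ¬ DAT u v w su bu sv bv sw bw

module Submission where

-- For x ≠ y the defining clauses of f sort the pair (x , y) into two classes:
-- Left pairs, where f x y = x, and Right pairs, where f x y = y.  The whole
-- proof rests on two structural facts about H⁺:
--   * H⁺ is symmetric under reversing arcs and swapping coordinates, so
--     "special" is closed backwards along paths and the classes of a
--     component and of its coupled component are exchanged by swapping;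
--   * no arc of H⁺ leads from a Left pair to a Right pair (for the enumerated
--     components this is where the ordering C₁,…,C₂ₖ is used).
-- Polymorphism follows because the only problematic arcs of f are exactly
-- such Left-to-Right arcs of H⁺; commutativity on a non-invertible pair
-- holds because swapping turns a Left pair into a Right pair and back; and
-- associativity holds for every commutative, idempotent, conservative
-- operation on a two-element set.  The classification of pairs needs
-- excluded middle, so it is carried out in the double-negation monad and
-- discharged at the end, as all conclusions are decidable equalities.

open import Defs
open import Level using (0ℓ)
open import Data.Nat using (ℕ; suc; _+_; _*_; _∸_; _≤_; _<_; _≤?_; s≤s)
open import Data.Nat.Properties
  using (≤-trans; <-trans; <⇒≱; ≰⇒>; +-comm; m≤m+n; ∸-monoʳ-≤; m+n∸n≡m; m+n∸m≡n;
         m<n⇒0<n∸m; m∸[m∸n]≡n)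
open import Data.Nat.Solver using (module +-*-Solver)
open import Data.Fin using (Fin; _≟_)
open import Data.Bool using (Bool; true)
import Data.Bool as Bool
open import Data.Product using (_×_; _,_; proj₁; proj₂)
open import Data.Sum as Sum using (_⊎_; inj₁; inj₂; [_,_])
open import Data.Empty using (⊥; ⊥-elim)
open import Effect.Monad using (RawMonad)
open import Relation.Binary.PropositionalEquality
  using (_≡_; _≢_; refl; sym; trans; cong; subst; subst₂)
open import Relation.Nullary using (¬_; yes; no)
open import Relation.Nullary.Negation using (¬¬-Monad; ¬¬-map)
open import Relation.Nullary.Decidable using (decidable-stable; ¬¬-excluded-middle)
open import Relation.Binary.Construct.Closure.ReflexiveTransitive using (ε; _◅_; _◅◅_)

open RawMonad (¬¬-Monad {a = 0ℓ}) using (_>>=_; return)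

-- Arithmetic of the mirror map j ↦ 2k+1−j, which sends the index of a
-- component Cᵢ to the index of its coupled component C₂ₖ₊₁₋ᵢ.
module Mirror (k : ℕ) where

  mirror : ℕ → ℕ
  mirror j = 2 * k + 1 ∸ j

  private
    open +-*-Solver

    2k+1≡1+k+k : 2 * k + 1 ≡ suc k + k
    2k+1≡1+k+k = solve 1 (λ k → con 2 :* k :+ con 1 := (con 1 :+ k) :+ k) refl k

  mirror-low : ∀ {j} → j ≤ k → k < mirror j
  mirror-low {j} j≤k rewrite 2k+1≡1+k+k =
    subst (_≤ suc k + k ∸ j) (m+n∸n≡m (suc k) k) (∸-monoʳ-≤ (suc k + k) j≤k)

  mirror-high : ∀ {j} → k < j → mirror j ≤ k
  mirror-high {j} k<j rewrite 2k+1≡1+k+k =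
    subst (suc k + k ∸ j ≤_) (m+n∸m≡n (suc k) k) (∸-monoʳ-≤ (suc k + k) k<j)

  mirror-positive : ∀ {j} → j ≤ 2 * k → 1 ≤ mirror j
  mirror-positive {j} j≤2k =
    m<n⇒0<n∸m (subst (j <_) (+-comm 1 (2 * k)) (s≤s j≤2k))

  mirror-involutive : ∀ {j} → j ≤ 2 * k → mirror (mirror j) ≡ j
  mirror-involutive {j} j≤2k = m∸[m∸n]≡n (≤-trans j≤2k (m≤m+n (2 * k) 1))

module _ {A : Set} (g : A → A → A) {m o : A}
         (mm : g m m ≡ m) (oo : g o o ≡ o) (mo : g m o ≡ m) (om : g o m ≡ m) where

  private
    via : ∀ {a b c u v w} → g a b ≡ u → g u c ≡ w → g b c ≡ v → g a v ≡ w →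
          g (g a b) c ≡ g a (g b c)
    via {a} {b} {c} ab≡u uc≡w bc≡v av≡w =
      trans (cong (λ t → g t c) ab≡u) (trans uc≡w (sym (trans (cong (g a) bc≡v) av≡w)))

  absorbing-assoc : ∀ a b c → (a ≡ m ⊎ a ≡ o) → (b ≡ m ⊎ b ≡ o) → (c ≡ m ⊎ c ≡ o) →
                    g (g a b) c ≡ g a (g b c)
  absorbing-assoc a b c (inj₁ refl) (inj₁ refl) (inj₁ refl) = via mm mm mm mm
  absorbing-assoc a b c (inj₁ refl) (inj₁ refl) (inj₂ refl) = via mm mo mo mm
  absorbing-assoc a b c (inj₁ refl) (inj₂ refl) (inj₁ refl) = via mo mm om mm
  absorbing-assoc a b c (inj₁ refl) (inj₂ refl) (inj₂ refl) = via mo mo oo mo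
  absorbing-assoc a b c (inj₂ refl) (inj₁ refl) (inj₁ refl) = via om mm mm om
  absorbing-assoc a b c (inj₂ refl) (inj₁ refl) (inj₂ refl) = via om mo mo om
  absorbing-assoc a b c (inj₂ refl) (inj₂ refl) (inj₁ refl) = via oo om om om
  absorbing-assoc a b c (inj₂ refl) (inj₂ refl) (inj₂ refl) = via oo oo oo oo

-- A commutative operation, idempotent on x and y, with g x y ∈ {x, y}, is
-- associative on {x, y}: whichever of x, y is g x y is absorbing.
two-element-assoc : ∀ {A : Set} (g : A → A → A) {x y : A} →
  g x x ≡ x → g y y ≡ y → g x y ≡ g y x → (g x y ≡ x ⊎ g x y ≡ y) →
  ∀ a b c → (a ≡ x ⊎ a ≡ y) → (b ≡ x ⊎ b ≡ y) → (c ≡ x ⊎ c ≡ y) →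
  g (g a b) c ≡ g a (g b c)
two-element-assoc g xx yy comm (inj₁ xy≡x) a b c =
  absorbing-assoc g xx yy xy≡x (trans (sym comm) xy≡x) a b c
two-element-assoc g xx yy comm (inj₂ xy≡y) a b c a∈ b∈ c∈ =
  absorbing-assoc g yy xx (trans (sym comm) xy≡y) xy≡y a b c
    (Sum.swap a∈) (Sum.swap b∈) (Sum.swap c∈)

module PairDigraph {n : ℕ} (E : Fin n → Fin n → Bool) where

  arc⁺-swap : ∀ {p q} → Arc⁺ E p q → Arc⁺ E (swap E q) (swap E p)
  arc⁺-swap {_ , _} {_ , _} (inj₁ (uu' , vv' , ¬uv')) = inj₂ (vv' , uu' , ¬uv')
  arc⁺-swap {_ , _} {_ , _} (inj₂ (u'u , v'v , ¬v'u)) = inj₁ (v'v , u'u , ¬v'u)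

  reach-swap : ∀ {p q} → Reach E p q → Reach E (swap E q) (swap E p)
  reach-swap ε          = ε
  reach-swap (pq ◅ qr) = reach-swap qr ◅◅ (arc⁺-swap pq ◅ ε)

  sameComp-refl : ∀ {p} → SameComp E p p
  sameComp-refl = ε , ε

  sameComp-sym : ∀ {p q} → SameComp E p q → SameComp E q p
  sameComp-sym (pq , qp) = qp , pq

  sameComp-trans : ∀ {p q r} → SameComp E p q → SameComp E q r → SameComp E p r
  sameComp-trans (pq , qp) (qr , rq) = pq ◅◅ qr , rq ◅◅ qp

  sameComp-swap : ∀ {p q} → SameComp E p q → SameComp E (swap E p) (swap E q)
  sameComp-swap (pq , qp) = reach-swap qp , reach-swap pq

  sameComp-swapˡ : ∀ {q p} → SameComp E (swap E q) p → SameComp E q (swap E p)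
  sameComp-swapˡ {_ , _} = sameComp-swap

  -- if p reaches a special vertex q, then p is special: p → q → swap q → swap p
  special-backward : ∀ {p q} → Reach E p q → Special E q → Special E p
  special-backward pq q-sp = pq ◅◅ q-sp ◅◅ reach-swap pq

  specialComp-intro : ∀ {p} → Special E p → SpecialComp E p
  specialComp-intro p-sp q (qp , _) = special-backward qp p-sp

  specialComp-elim : ∀ {p} → SpecialComp E p → Special E p
  specialComp-elim sp = sp _ sameComp-refl

  coSpecialComp-intro : ∀ {p} → Special E (swap E p) → CoSpecialComp E p
  coSpecialComp-intro {_ , _} sp q c = specialComp-intro sp q (sameComp-swapˡ c)

  coSpecialComp-elim : ∀ {p} → CoSpecialComp E p → Special E (swap E p)
  coSpecialComp-elim {_ , _} cs = cs _ sameComp-refl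

  selfCoupled-intro : ∀ {p} → SameComp E p (swap E p) → SelfCoupled E p
  selfCoupled-intro p~p' q = to , to
    where
    to : ∀ {r} → SameComp E r _ → SameComp E (swap E r) _
    to r~p = sameComp-trans (sameComp-swap r~p) (sameComp-sym p~p')

  selfCoupled-elim : ∀ {p} → SelfCoupled E p → SameComp E p (swap E p)
  selfCoupled-elim sc = sameComp-sym (proj₁ (sc _) sameComp-refl)

  specialComp-swap : ∀ {p} → SpecialComp E p → CoSpecialComp E (swap E p)
  specialComp-swap {_ , _} sp = coSpecialComp-intro (specialComp-elim sp)

  coSpecialComp-swap : ∀ {p} → CoSpecialComp E p → SpecialComp E (swap E p)
  coSpecialComp-swap cs = specialComp-intro (coSpecialComp-elim cs)

  notSelfCoupled-swap : ∀ {p} → ¬ SelfCoupled E p → ¬ SelfCoupled E (swap E p)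
  notSelfCoupled-swap {_ , _} ¬sc sc =
    ¬sc (selfCoupled-intro (sameComp-sym (selfCoupled-elim sc)))

  neither-swap : ∀ {p} → Neither E p → Neither E (swap E p)
  neither-swap {_ , _} (x≢y , ¬sp , ¬cs) =
    (λ y≡x → x≢y (sym y≡x)) , (λ sp → ¬cs (specialComp-swap sp))
                            , (λ cs → ¬sp (coSpecialComp-swap cs))

module Classes {n : ℕ} (E : Fin n → Fin n → Bool) (e : Enumeration E) where
  open Enumeration e
  open PairDigraph E
  open Mirror k

  Left : P E → Set
  Left p = (CoSpecialComp E p × ¬ SelfCoupled E p) ⊎ (Neither E p × k < idx p)

  Right : P E → Set
  Right p = SelfCoupled E p ⊎ (SpecialComp E p × ¬ SelfCoupled E p)
                            ⊎ (Neither E p × idx p ≤ k)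

  idx-swap-low : ∀ {p} → Neither E p → idx p ≤ k → k < idx (swap E p)
  idx-swap-low N low = subst (k <_) (sym (proj₂ (coupled _ N low))) (mirror-low low)

  -- and an upper-half component to the lower half: Cⱼ with j > k is the
  -- coupled component of the lower-half component C₂ₖ₊₁₋ⱼ
  idx-swap-high : ∀ {p} → Neither E p → k < idx p → idx (swap E p) ≤ k
  idx-swap-high {p} N high
    with onto (mirror (idx p)) (mirror-positive (proj₂ (range p N)))
              (≤-trans (mirror-high high) (m≤m+n k (k + 0)))
  ... | r , Nr , idx-r = subst (_≤ k) (sym idx-p'≡idx-r) r-low
    where
    j≤2k : idx p ≤ 2 * k
    j≤2k = proj₂ (range p N)
    r-low : idx r ≤ k
    r-low = subst (_≤ k) (sym idx-r) (mirror-high high)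
    idx-r'≡idx-p : idx (swap E r) ≡ idx p
    idx-r'≡idx-p = trans (proj₂ (coupled r Nr r-low))
                         (trans (cong mirror idx-r) (mirror-involutive j≤2k))
    r~p' : SameComp E r (swap E p)
    r~p' = sameComp-swapˡ (sameIdx _ p (proj₁ (coupled r Nr r-low)) N idx-r'≡idx-p)
    idx-p'≡idx-r : idx (swap E p) ≡ idx r
    idx-p'≡idx-r = idxSame _ r (neither-swap N) Nr (sameComp-sym r~p')

  left-swap : ∀ {p} → Left p → Right (swap E p)
  left-swap (inj₁ (cs , ¬sc)) = inj₂ (inj₁ (coSpecialComp-swap cs , notSelfCoupled-swap ¬sc))
  left-swap (inj₂ (N , high)) = inj₂ (inj₂ (neither-swap N , idx-swap-high N high))

  right-swap : ∀ {p} → ¬ SameComp E p (swap E p) → Right p → Left (swap E p)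
  right-swap ¬p~p' (inj₁ sc) = ⊥-elim (¬p~p' (selfCoupled-elim sc))
  right-swap ¬p~p' (inj₂ (inj₁ (sp , ¬sc))) =
    inj₁ (specialComp-swap sp , notSelfCoupled-swap ¬sc)
  right-swap ¬p~p' (inj₂ (inj₂ (N , low))) = inj₂ (neither-swap N , idx-swap-low N low)

  right-special : ∀ {q} → Right q → Special E q ⊎ (Neither E q × idx q ≤ k)
  right-special (inj₁ sc) = inj₁ (proj₁ (selfCoupled-elim sc))
  right-special (inj₂ (inj₁ (sp , _))) = inj₁ (specialComp-elim sp)
  right-special (inj₂ (inj₂ low)) = inj₂ low

  no-left-to-right : ∀ {p q} → Arc⁺ E p q → Left p → Right q → ⊥
  no-left-to-right {p} {q} pq left right = go left (right-special right)
    where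
    go : Left p → Special E q ⊎ (Neither E q × idx q ≤ k) → ⊥
    -- p reaches the special q, and swap p reaches p: p is self-coupled
    go (inj₁ (cs , ¬sc)) (inj₁ q-sp) =
      ¬sc (selfCoupled-intro (special-backward (pq ◅ ε) q-sp , p'-to-p))
      where
      p'-to-p : Reach E (swap E p) p
      p'-to-p = cs (swap E p) (sameComp-swap sameComp-refl)
    -- swap q reaches the special swap p, so q is co-special
    go (inj₁ (cs , _)) (inj₂ (Nq , _)) =
      proj₂ (proj₂ Nq)
        (coSpecialComp-intro (special-backward (reach-swap (pq ◅ ε)) (coSpecialComp-elim cs)))
    -- p reaches the special q, so p is special
    go (inj₂ (Np , _)) (inj₁ q-sp) =
      proj₁ (proj₂ Np) (specialComp-intro (special-backward (pq ◅ ε) q-sp))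
    -- enumerated components: the arc cannot go down from the upper half
    go (inj₂ (Np , high)) (inj₂ (Nq , low)) = ¬¬-excluded-middle λ where
      (yes p~q) → <⇒≱ (subst (k <_) (idxSame p q Np Nq p~q) high) low
      (no ¬p~q) → <⇒≱ (<-trans high (order p q Np Nq pq ¬p~q)) low

module DefinedMap {n : ℕ} (E : Fin n → Fin n → Bool) (e : Enumeration E)
                  (f : Fin n → Fin n → Fin n) (d : IsDefinedMap E e f) where
  open Enumeration e
  open IsDefinedMap d
  open Classes E e

  f-left : ∀ {x y} → x ≢ y → Left (x , y) → f x y ≡ x
  f-left x≢y (inj₁ (cs , ¬sc)) = coSpecial _ _ x≢y cs ¬sc
  f-left x≢y (inj₂ (N , high)) = highHalf _ _ N high

  f-right : ∀ {x y} → x ≢ y → Right (x , y) → f x y ≡ y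
  f-right x≢y (inj₁ sc) = selfCoup _ _ x≢y sc
  f-right x≢y (inj₂ (inj₁ (sp , ¬sc))) = special _ _ x≢y sp ¬sc
  f-right x≢y (inj₂ (inj₂ (N , low))) = lowHalf _ _ N low

  classify : ∀ {x y} → x ≢ y → ¬ ¬ (Left (x , y) ⊎ Right (x , y))
  classify {x} {y} x≢y = do
    no ¬sc ← ¬¬-excluded-middle {A = SelfCoupled E (x , y)}
      where yes sc → return (inj₂ (inj₁ sc))
    no ¬sp ← ¬¬-excluded-middle {A = SpecialComp E (x , y)}
      where yes sp → return (inj₂ (inj₂ (inj₁ (sp , ¬sc))))
    no ¬cs ← ¬¬-excluded-middle {A = CoSpecialComp E (x , y)}
      where yes cs → return (inj₁ (inj₁ (cs , ¬sc)))
    let N = x≢y , ¬sp , ¬cs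
    yes low ← return (idx (x , y) ≤? k)
      where no ¬low → return (inj₁ (inj₂ (N , ≰⇒> ¬low)))
    return (inj₂ (inj₂ (inj₂ (N , low))))

  conservative : ∀ x y → ¬ ¬ (f x y ≡ x ⊎ f x y ≡ y)
  conservative x y with x ≟ y
  ... | yes refl = return (inj₁ (diag x))
  ... | no x≢y   = ¬¬-map (Sum.map (f-left x≢y) (f-right x≢y)) (classify x≢y)

  picks-first : ∀ {x y} → x ≢ y → f x y ≡ x → ¬ ¬ Left (x , y)
  picks-first x≢y fx = ¬¬-map [ (λ l → l) , (λ r → ⊥-elim (x≢y (trans (sym fx) (f-right x≢y r)))) ]
                              (classify x≢y)

  picks-second : ∀ {x y} → x ≢ y → f x y ≡ y → ¬ ¬ Right (x , y)
  picks-second x≢y fy = ¬¬-map [ (λ l → ⊥-elim (x≢y (trans (sym (f-left x≢y l)) fy))) , (λ r → r) ]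
                               (classify x≢y)

  no-first-to-second : ∀ {x y x' y'} → Arc⁺ E (x , y) (x' , y') → x ≢ y → x' ≢ y' →
                       f x y ≡ x → f x' y' ≡ y' → ⊥
  no-first-to-second xy→x'y' x≢y x'≢y' fx fy' =
    picks-first x≢y fx λ left → picks-second x'≢y' fy' λ right →
      no-left-to-right xy→x'y' left right

  first-to-second : ∀ {x x' y y'} → Arc E x x' → Arc E y y' →
                    f x y ≡ x → f x' y' ≡ y' → Arc E x y'
  first-to-second {x} {x'} {y} {y'} xx' yy' fx fy' =
    decidable-stable (E x y' Bool.≟ true) λ ¬xy' →
      no-first-to-second (inj₁ (xx' , yy' , ¬xy'))
        (λ { refl → ¬xy' yy' }) (λ { refl → ¬xy' xx' }) fx fy'

  second-to-first : ∀ {x x' y y'} → Arc E x x' → Arc E y y' →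
                    f x y ≡ y → f x' y' ≡ x' → Arc E y x'
  second-to-first {x} {x'} {y} {y'} xx' yy' fy fx' =
    decidable-stable (E y x' Bool.≟ true) λ ¬yx' →
      no-first-to-second (inj₂ (xx' , yy' , ¬yx'))
        (λ { refl → ¬yx' yy' }) (λ { refl → ¬yx' xx' }) fx' fy

  polymorphism : IsPolymorphism E f
  polymorphism x x' y y' xx' yy' =
    decidable-stable (E (f x y) (f x' y') Bool.≟ true) do
      v  ← conservative x y
      v' ← conservative x' y'
      return (arc v v')
    where
    arc : (f x y ≡ x ⊎ f x y ≡ y) → (f x' y' ≡ x' ⊎ f x' y' ≡ y') → Arc E (f x y) (f x' y')
    arc (inj₁ fx) (inj₁ fx') = subst₂ (Arc E) (sym fx) (sym fx') xx'
    arc (inj₂ fy) (inj₂ fy') = subst₂ (Arc E) (sym fy) (sym fy') yy'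
    arc (inj₁ fx) (inj₂ fy') = subst₂ (Arc E) (sym fx) (sym fy') (first-to-second xx' yy' fx fy')
    arc (inj₂ fy) (inj₁ fx') = subst₂ (Arc E) (sym fy) (sym fx') (second-to-first xx' yy' fy fx')

  -- on a non-invertible pair, swapping exchanges the classes, so f commutes
  commutes : ∀ {x y} → x ≢ y → ¬ Invertible E x y → f x y ≡ f y x
  commutes {x} {y} x≢y ¬inv =
    decidable-stable (f x y ≟ f y x) (¬¬-map [ via-left , via-right ] (classify x≢y))
    where
    y≢x : y ≢ x
    y≢x y≡x = x≢y (sym y≡x)
    via-left : Left (x , y) → f x y ≡ f y x
    via-left l = trans (f-left x≢y l) (sym (f-right y≢x (left-swap l)))
    via-right : Right (x , y) → f x y ≡ f y x
    via-right r = trans (f-right x≢y r)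
                        (sym (f-left y≢x (right-swap (λ c → ¬inv (x≢y , c)) r)))

  semilattice : ∀ x y → x ≢ y → ¬ Invertible E x y → SemilatticeOn E f x y
  semilattice x y x≢y ¬inv = comm , diag x , diag y , assoc
    where
    comm : f x y ≡ f y x
    comm = commutes x≢y ¬inv
    assoc : ∀ a b c → (a ≡ x ⊎ a ≡ y) → (b ≡ x ⊎ b ≡ y) → (c ≡ x ⊎ c ≡ y) →
            f (f a b) c ≡ f a (f b c)
    assoc a b c a∈ b∈ c∈ =
      decidable-stable (f (f a b) c ≟ f a (f b c))
        (¬¬-map (λ v → two-element-assoc f (diag x) (diag y) comm v a b c a∈ b∈ c∈)
                (conservative x y))

lemma10 : ∀ {n : ℕ} (E : Fin n → Fin n → Bool) → DATFree E →
    (e : Enumeration E) (f : Fin n → Fin n → Fin n) → IsDefinedMap E e f →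
      IsPolymorphism E f
    × (∀ x y → x ≢ y → ¬ Invertible E x y → SemilatticeOn E f x y)
lemma10 E _ e f d = polymorphism , semilattice
  where open DefinedMap E e f d
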